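{- Let $n = 2^k p^2$, where $p$ is an odd prime and $k$ is a positive integer, be a $2$-near perfect number whose omitted divisors are $d_1 = p^j$ for some $j \in \{1,2\}$ and $d_2 = 2^b p^g$ for some $g \in \{1,2\}$ and some integer $b$ with $1 \le b \le k$. Then $n = 200$.
   Context: $\sigma(n)$ denotes the sum of the positive divisors of $n$. A positive integer $n$ is called $2$-near perfect if $\sigma(n) = 2n + d_1 + d_2$ for some two distinct positive divisors $d_1, d_2$ of $n$; these $d_1, d_2$ are called the omitted divisors. -}

module Defs where

open import Data.Nat using (ℕ; zero; suc; _+_; _*_)
open import Data.Nat.Divisibility using (_∣_; _∣?_)
open import Data.List using (List; filter; upTo; map)
open import Data.Nat.ListAction using (sum)
open import Data.Product using (_×_; ∃-syntax)
open import Relation.Binary.PropositionalEquality using (_≡_)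
open import Relation.Nullary using (¬_)

σ : ℕ → ℕ
σ n = sum (filter (_∣? n) (map suc (upTo n)))

NearPerfectWith : ℕ → ℕ → ℕ → Set
NearPerfectWith n d₁ d₂ =
  (d₁ ∣ n) × (d₂ ∣ n) × ¬ (d₁ ≡ d₂) × ¬ (d₁ ≡ 0) × ¬ (d₂ ≡ 0) × (σ n ≡ 2 * n + d₁ + d₂)

-- Splitting the divisors of 2x into even and odd ones gives σ(2x) = 2σ(x) + σₒ(x), where the
-- odd-divisor sum σₒ is unchanged by doubling and equals σ on odd numbers; hence, with N = 2^(k+1),
-- σ(2^k q) + σ(q) = N σ(q) for odd q.  As σ(p²) = 1 + p + p², the near-perfect equation becomes
-- N(1 + p) = 1 + p + p² + p^j + B p^g with B = 2^b.  So N ≡ 1 (mod p), say N = 1 + m p, and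
-- m(1 + p) = p + p^(j-1) + B p^(g-1); moreover 2B ∣ N since b ≤ k.  Solving for B in each of the four
-- cases, N either lies strictly between two consecutive multiples of 2B or violates 2B ∣ N by
-- parity, except when j = 2, g = 1 and m = 3: then B = p + 3 and N = 2B forces p = 5, N = 16.

module Submission where

open import Defs
open import Data.Nat using (ℕ; zero; suc; _+_; _*_; _^_; _≤_; _<_; _≟_; z≤n; s≤s; z<s; NonZero; nonTrivial⇒n>1)
open import Data.Nat.Properties
open import Data.Nat.Divisibility
open import Data.Nat.DivMod using (_%_; _/_; [m+kn]%n≡m%n; m<n⇒m%n≡m; m≡m%n+[m/n]*n; m%n<n)
open import Data.Nat.Primality using (Prime; prime⇒irreducible; prime⇒nonZero; prime⇒nonTrivial; prime[2]; euclidsLemma)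
open import Data.Nat.Coprimality using (Coprime; coprime-divisor)
import Data.Nat.Coprimality as Coprimality
open import Data.Nat.ListAction using (sum)
open import Data.Nat.ListAction.Properties using (sum-++)
open import Data.List using ([]; _∷_; [_]; _++_; filter; map; upTo)
open import Data.List.Properties using (upTo-∷ʳ; map-++; map-applyUpTo)
open import Data.Product using (_×_; _,_; ∃-syntax)
open import Data.Sum using (_⊎_; inj₁; inj₂)
import Data.Sum as Sum
open import Data.Empty using (⊥; ⊥-elim)
open import Function using (_∘_; id)
open import Relation.Binary.PropositionalEquality using (_≡_; _≢_; refl; sym; trans; cong; cong₂; subst; module ≡-Reasoning)
open import Relation.Nullary using (¬_; yes; no; contradiction)
open import Data.Nat.Tactic.RingSolver using (solve-∀)

<-gap : ∀ {x y} c → y ≡ x + suc c → x < y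
<-gap {x} c refl = m<m+n x z<s

0∤1+n : ∀ {n} → ¬ 0 ∣ suc n
0∤1+n 0∣1+n = 1+n≢0 (0∣⇒≡0 0∣1+n)

∤-between : ∀ {a q n} → a * q < n → n < a * suc q → ¬ a ∣ n
∤-between {a} {q} aq<n n<a[1+q] (divides r refl) = <⇒≱ q<r (m<1+n⇒m≤n r<1+q)
  where
  q<r : q < r
  q<r = *-cancelʳ-< a q r (subst (_< r * a) (*-comm a q) aq<n)
  r<1+q : r < suc q
  r<1+q = *-cancelʳ-< a r (suc q) (subst (r * a <_) (*-comm a (suc q)) n<a[1+q])

coprime-1+ : ∀ n → Coprime n (suc n)
coprime-1+ n {d} (d∣n , d∣1+n) = ∣1⇒≡1 (∣m+n∣m⇒∣n (subst (d ∣_) (+-comm 1 n) d∣1+n) d∣n)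

prime∤⇒coprime : ∀ {p n} → Prime p → ¬ p ∣ n → Coprime p n
prime∤⇒coprime pr p∤n (d∣p , d∣n) with prime⇒irreducible pr d∣p
... | inj₁ d≡1 = d≡1
... | inj₂ refl = contradiction d∣n p∤n

2∤1+2* : ∀ e → ¬ 2 ∣ suc (2 * e)
2∤1+2* e (divides q eq) = even≢odd q e (sym (trans eq (*-comm q 2)))

odd⇒≡1+2* : ∀ {n} → ¬ 2 ∣ n → ∃[ h ] n ≡ 1 + 2 * h
odd⇒≡1+2* {n} 2∤n with n % 2 in n%2≡ | m%n<n n 2
... | 0 | _ = contradiction (m%n≡0⇒n∣m n 2 n%2≡) 2∤n
... | 1 | _ = n / 2 , trans (m≡m%n+[m/n]*n n 2) (trans (cong (_+ n / 2 * 2) n%2≡) (cong suc (*-comm (n / 2) 2)))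
... | suc (suc _) | s≤s (s≤s ())

prime≢2⇒2∤ : ∀ {p} → Prime p → p ≢ 2 → ¬ 2 ∣ p
prime≢2⇒2∤ pr p≢2 2∣p with prime⇒irreducible pr 2∣p
... | inj₂ 2≡p = p≢2 (sym 2≡p)

^-monoʳ-∣ : ∀ m {b k} → b ≤ k → m ^ b ∣ m ^ k
^-monoʳ-∣ m {b} b≤k with m≤n⇒∃[o]m+o≡n b≤k
... | c , refl = divides (m ^ c) (trans (^-distribˡ-+-* m b c) (*-comm (m ^ b) (m ^ c)))

∑< : ℕ → (ℕ → ℕ) → ℕ
∑< zero    f = 0
∑< (suc n) f = ∑< n f + f n

∑<-cong : ∀ {f g} → (∀ d → f d ≡ g d) → ∀ n → ∑< n f ≡ ∑< n g
∑<-cong f≗g zero    = refl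
∑<-cong f≗g (suc n) = cong₂ _+_ (∑<-cong f≗g n) (f≗g n)

∑<-+ : ∀ f g n → ∑< n (λ d → f d + g d) ≡ ∑< n f + ∑< n g
∑<-+ f g zero    = refl
∑<-+ f g (suc n) = trans (cong (_+ (f n + g n)) (∑<-+ f g n)) (swap (∑< n f) (∑< n g) (f n) (g n))
  where
  swap : ∀ a b c d → a + b + (c + d) ≡ a + c + (b + d)
  swap = solve-∀

∑<-*ˡ : ∀ c f n → ∑< n (λ d → c * f d) ≡ c * ∑< n f
∑<-*ˡ c f zero    = sym (*-zeroʳ c)
∑<-*ˡ c f (suc n) = trans (cong (_+ c * f n) (∑<-*ˡ c f n)) (sym (*-distribˡ-+ c (∑< n f) (f n)))

∑<-stable : ∀ {f L} → (∀ d → L ≤ d → f d ≡ 0) → ∀ {n} → L ≤ n → ∑< n f ≡ ∑< L f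
∑<-stable vanish {zero} z≤n = refl
∑<-stable {L = L} vanish {suc n} L≤1+n with L ≟ suc n
... | yes refl = refl
... | no L≢1+n = trans (cong₂ _+_ (∑<-stable vanish L≤n) (vanish n L≤n)) (+-identityʳ _)
  where L≤n = m<1+n⇒m≤n (≤∧≢⇒< L≤1+n L≢1+n)

∑<-evens+odds : ∀ f n → ∑< (2 * n) f ≡ ∑< n (f ∘ (2 *_)) + ∑< n (f ∘ suc ∘ (2 *_))
∑<-evens+odds f zero    = refl
∑<-evens+odds f (suc n) = begin
  ∑< (2 * suc n) f                                     ≡⟨ cong (λ m → ∑< m f) (*-suc 2 n) ⟩
  ∑< (2 * n) f + f (2 * n) + f (suc (2 * n))           ≡⟨ cong (λ s → s + f (2 * n) + f (suc (2 * n))) (∑<-evens+odds f n) ⟩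
  E + O + f (2 * n) + f (suc (2 * n))                  ≡⟨ regroup E O (f (2 * n)) (f (suc (2 * n))) ⟩
  (E + f (2 * n)) + (O + f (suc (2 * n)))              ∎
  where
  open ≡-Reasoning
  E = ∑< n (f ∘ (2 *_))
  O = ∑< n (f ∘ suc ∘ (2 *_))
  regroup : ∀ a b c d → a + b + c + d ≡ a + c + (b + d)
  regroup = solve-∀

δ : ℕ → ℕ → ℕ
δ a d with d ≟ a
... | yes _ = a
... | no  _ = 0

δ-diag : ∀ a → δ a a ≡ a
δ-diag a with a ≟ a
... | yes _   = refl
... | no  a≢a = contradiction refl a≢a

δ-off : ∀ {a d} → d ≢ a → δ a d ≡ 0
δ-off {a} {d} d≢a with d ≟ a
... | yes d≡a = contradiction d≡a d≢a
... | no  _   = refl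

∑<-δ-below : ∀ {a} n → n ≤ a → ∑< n (δ a) ≡ 0
∑<-δ-below zero    _     = refl
∑<-δ-below (suc n) n<a = cong₂ _+_ (∑<-δ-below n (<⇒≤ n<a)) (δ-off (<⇒≢ n<a))

∑<-δ : ∀ a {n} → a < n → ∑< n (δ a) ≡ a
∑<-δ a a<n = trans (∑<-stable (λ d a<d → δ-off (>⇒≢ a<d)) a<n) (cong₂ _+_ (∑<-δ-below a ≤-refl) (δ-diag a))

divisorTerm : ℕ → ℕ → ℕ
divisorTerm n d with d ∣? n
... | yes _ = d
... | no  _ = 0

divisorTerm-∣ : ∀ {n d} → d ∣ n → divisorTerm n d ≡ d
divisorTerm-∣ {n} {d} d∣n with d ∣? n
... | yes _   = refl
... | no  d∤n = contradiction d∣n d∤n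

divisorTerm-∤ : ∀ {n d} → ¬ d ∣ n → divisorTerm n d ≡ 0
divisorTerm-∤ {n} {d} d∤n with d ∣? n
... | yes d∣n = contradiction d∣n d∤n
... | no  _   = refl

divisorTerm-zero : ∀ n → divisorTerm n 0 ≡ 0
divisorTerm-zero n with 0 ∣? n
... | yes _ = refl
... | no  _ = refl

divisorTerm-> : ∀ {n d} .{{_ : NonZero n}} → n < d → divisorTerm n d ≡ 0
divisorTerm-> n<d = divisorTerm-∤ (>⇒∤ n<d)

sum-filter-∣ : ∀ n xs → sum (filter (_∣? n) xs) ≡ sum (map (divisorTerm n) xs)
sum-filter-∣ n []       = refl
sum-filter-∣ n (x ∷ xs) with x ∣? n
... | yes _ = cong (x +_) (sum-filter-∣ n xs)
... | no  _ = sum-filter-∣ n xs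

sum-map-upTo : ∀ f n → sum (map f (upTo n)) ≡ ∑< n f
sum-map-upTo f zero    = refl
sum-map-upTo f (suc n) = begin
  sum (map f (upTo (suc n)))            ≡⟨ cong (sum ∘ map f) (upTo-∷ʳ n) ⟨
  sum (map f (upTo n ++ [ n ]))         ≡⟨ cong sum (map-++ f (upTo n) [ n ]) ⟩
  sum (map f (upTo n) ++ [ f n ])       ≡⟨ sum-++ (map f (upTo n)) [ f n ] ⟩
  sum (map f (upTo n)) + (f n + 0)      ≡⟨ cong₂ _+_ (sum-map-upTo f n) (+-identityʳ (f n)) ⟩
  ∑< n f + f n                          ∎
  where open ≡-Reasoning

σ≡∑ : ∀ n → σ n ≡ ∑< (suc n) (divisorTerm n)
σ≡∑ n = begin
  σ n                                         ≡⟨ sum-filter-∣ n candidates ⟩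
  sum (map (divisorTerm n) candidates)        ≡⟨ cong (_+ sum (map (divisorTerm n) candidates)) (divisorTerm-zero n) ⟨
  sum (map (divisorTerm n) (0 ∷ candidates))  ≡⟨ cong (sum ∘ map (divisorTerm n) ∘ (0 ∷_)) (map-applyUpTo id suc n) ⟩
  sum (map (divisorTerm n) (upTo (suc n)))    ≡⟨ sum-map-upTo (divisorTerm n) (suc n) ⟩
  ∑< (suc n) (divisorTerm n)                  ∎
  where
  open ≡-Reasoning
  candidates = map suc (upTo n)

σ≡∑-beyond : ∀ n .{{_ : NonZero n}} {M} → n < M → σ n ≡ ∑< M (divisorTerm n)
σ≡∑-beyond n n<M = trans (σ≡∑ n) (sym (∑<-stable (λ _ n<d → divisorTerm-> n<d) n<M))

σₒ : ℕ → ℕ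
σₒ n = ∑< (suc n) (λ e → divisorTerm n (suc (2 * e)))

σₒ-beyond : ∀ n .{{_ : NonZero n}} {M} → n < M → σₒ n ≡ ∑< M (λ e → divisorTerm n (suc (2 * e)))
σₒ-beyond n n<M = sym (∑<-stable (λ e n<e → divisorTerm-> (s≤s (≤-trans (<⇒≤ n<e) (m≤m+n e (e + 0))))) n<M)

divisorTerm-*2-even : ∀ x e → divisorTerm (2 * x) (2 * e) ≡ 2 * divisorTerm x e
divisorTerm-*2-even x e with e ∣? x
... | yes e∣x = divisorTerm-∣ (*-monoʳ-∣ 2 e∣x)
... | no  e∤x = divisorTerm-∤ (e∤x ∘ *-cancelˡ-∣ 2)

divisorTerm-*2-odd : ∀ x e → divisorTerm (2 * x) (suc (2 * e)) ≡ divisorTerm x (suc (2 * e))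
divisorTerm-*2-odd x e with suc (2 * e) ∣? x
... | yes o∣x = divisorTerm-∣ (∣n⇒∣m*n 2 o∣x)
... | no  o∤x = divisorTerm-∤ (o∤x ∘ coprime-divisor (Coprimality.sym (prime∤⇒coprime prime[2] (2∤1+2* e))))

σ-*2 : ∀ x .{{_ : NonZero x}} → σ (2 * x) ≡ 2 * σ x + σₒ x
σ-*2 x = begin
  σ (2 * x)
    ≡⟨ σ≡∑-beyond (2 * x) {{m*n≢0 2 x}} (*-monoʳ-< 2 (n<1+n x)) ⟩
  ∑< (2 * suc x) (divisorTerm (2 * x))
    ≡⟨ ∑<-evens+odds (divisorTerm (2 * x)) (suc x) ⟩
  ∑< (suc x) (λ e → divisorTerm (2 * x) (2 * e)) + ∑< (suc x) (λ e → divisorTerm (2 * x) (suc (2 * e)))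
    ≡⟨ cong₂ _+_ (∑<-cong (divisorTerm-*2-even x) (suc x)) (∑<-cong (divisorTerm-*2-odd x) (suc x)) ⟩
  ∑< (suc x) (λ e → 2 * divisorTerm x e) + σₒ x
    ≡⟨ cong (_+ σₒ x) (∑<-*ˡ 2 (divisorTerm x) (suc x)) ⟩
  2 * ∑< (suc x) (divisorTerm x) + σₒ x
    ≡⟨ cong (λ s → 2 * s + σₒ x) (σ≡∑ x) ⟨
  2 * σ x + σₒ x
    ∎
  where open ≡-Reasoning

σₒ-*2 : ∀ x .{{_ : NonZero x}} → σₒ (2 * x) ≡ σₒ x
σₒ-*2 x = trans (∑<-cong (divisorTerm-*2-odd x) (suc (2 * x))) (sym (σₒ-beyond x (s≤s (m≤m+n x (x + 0)))))

σₒ-odd : ∀ x .{{_ : NonZero x}} → ¬ 2 ∣ x → σₒ x ≡ σ x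
σₒ-odd x 2∤x = sym (begin
  σ x
    ≡⟨ σ≡∑-beyond x (≤-trans (n<1+n x) (m≤m+n (suc x) (suc x + 0))) ⟩
  ∑< (2 * suc x) (divisorTerm x)
    ≡⟨ ∑<-evens+odds (divisorTerm x) (suc x) ⟩
  ∑< (suc x) (λ e → divisorTerm x (2 * e)) + σₒ x
    ≡⟨ cong (_+ σₒ x) (∑<-stable {L = 0} (λ e _ → divisorTerm-∤ (2∤x ∘ ∣-trans (m∣m*n e))) {suc x} z≤n) ⟩
  σₒ x
    ∎)
  where open ≡-Reasoning

module _ (q : ℕ) .{{_ : NonZero q}} (2∤q : ¬ 2 ∣ q) where

  private
    2^k*q≢0 : ∀ k → NonZero (2 ^ k * q)
    2^k*q≢0 k = m*n≢0 (2 ^ k) q {{m^n≢0 2 k}}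

  σₒ-2^k* : ∀ k → σₒ (2 ^ k * q) ≡ σ q
  σₒ-2^k* zero    = trans (cong σₒ (*-identityˡ q)) (σₒ-odd q 2∤q)
  σₒ-2^k* (suc k) = trans (cong σₒ (*-assoc 2 (2 ^ k) q)) (trans (σₒ-*2 (2 ^ k * q) {{2^k*q≢0 k}}) (σₒ-2^k* k))

  σ-2^k* : ∀ k → σ (2 ^ k * q) + σ q ≡ 2 ^ suc k * σ q
  σ-2^k* zero    = trans (cong (λ n → σ n + σ q) (*-identityˡ q)) (cong (σ q +_) (sym (+-identityʳ (σ q))))
  σ-2^k* (suc k) = begin
    σ (2 ^ suc k * q) + σ q             ≡⟨ cong (λ n → σ n + σ q) (*-assoc 2 (2 ^ k) q) ⟩
    σ (2 * x) + σ q                     ≡⟨ cong (_+ σ q) (σ-*2 x {{2^k*q≢0 k}}) ⟩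
    2 * σ x + σₒ x + σ q                ≡⟨ cong (λ s → 2 * σ x + s + σ q) (σₒ-2^k* k) ⟩
    2 * σ x + σ q + σ q                 ≡⟨ regroup (σ x) (σ q) ⟩
    2 * (σ x + σ q)                     ≡⟨ cong (2 *_) (σ-2^k* k) ⟩
    2 * (2 ^ suc k * σ q)               ≡⟨ *-assoc 2 (2 ^ suc k) (σ q) ⟨
    2 ^ suc (suc k) * σ q               ∎
    where
    open ≡-Reasoning
    x = 2 ^ k * q
    regroup : ∀ a b → 2 * a + b + b ≡ 2 * (a + b)
    regroup = solve-∀

module _ {p : ℕ} (pr : Prime p) where

  private
    instance
      p≢0 : NonZero p
      p≢0 = prime⇒nonZero pr

    1<p : 1 < p
    1<p = nonTrivial⇒n>1 p {{prime⇒nonTrivial pr}}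

    p<p*p : p < p * p
    p<p*p = subst (_< p * p) (*-identityʳ p) (*-monoʳ-< p 1<p)

  ∣p*p⇒1∨p∨p*p : ∀ {d} → d ∣ p * p → d ≡ 1 ⊎ d ≡ p ⊎ d ≡ p * p
  ∣p*p⇒1∨p∨p*p {d} d∣p*p with p ∣? d
  ... | no p∤d = Sum.map₂ inj₁ (prime⇒irreducible pr d∣p)
    where d∣p = coprime-divisor (Coprimality.sym (prime∤⇒coprime pr p∤d)) d∣p*p
  ... | yes (divides e refl) with prime⇒irreducible pr (*-cancelʳ-∣ {e} {p} p d∣p*p)
  ...   | inj₁ refl = inj₂ (inj₁ (*-identityˡ p))
  ...   | inj₂ refl = inj₂ (inj₂ refl)

  divisorTerm-p*p : ∀ d → divisorTerm (p * p) d ≡ δ 1 d + δ p d + δ (p * p) d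
  divisorTerm-p*p d with d ∣? p * p
  ... | no d∤p*p = sym (cong₂ _+_ (cong₂ _+_ (δ-off d≢1) (δ-off d≢p)) (δ-off d≢p*p))
    where
    d≢1 : d ≢ 1
    d≢1 refl = d∤p*p (1∣ (p * p))
    d≢p : d ≢ p
    d≢p refl = d∤p*p (m∣m*n p)
    d≢p*p : d ≢ p * p
    d≢p*p refl = d∤p*p ∣-refl
  ... | yes d∣p*p with ∣p*p⇒1∨p∨p*p d∣p*p
  ...   | inj₁ refl        =
    sym (cong₂ _+_ (cong₂ _+_ (δ-diag 1) (δ-off (<⇒≢ 1<p))) (δ-off (<⇒≢ (<-trans 1<p p<p*p))))
  ...   | inj₂ (inj₁ refl) =
    sym (trans (cong₂ _+_ (cong₂ _+_ (δ-off (>⇒≢ 1<p)) (δ-diag p)) (δ-off (<⇒≢ p<p*p))) (+-identityʳ p))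
  ...   | inj₂ (inj₂ refl) =
    sym (cong₂ _+_ (cong₂ _+_ (δ-off (>⇒≢ (<-trans 1<p p<p*p))) (δ-off (>⇒≢ p<p*p))) (δ-diag (p * p)))

  σ-p*p : σ (p * p) ≡ 1 + p + p * p
  σ-p*p = begin
    σ (p * p)
      ≡⟨ σ≡∑ (p * p) ⟩
    ∑< M (divisorTerm (p * p))
      ≡⟨ ∑<-cong divisorTerm-p*p M ⟩
    ∑< M (λ d → δ 1 d + δ p d + δ (p * p) d)
      ≡⟨ ∑<-+ (λ d → δ 1 d + δ p d) (δ (p * p)) M ⟩
    ∑< M (λ d → δ 1 d + δ p d) + ∑< M (δ (p * p))
      ≡⟨ cong (_+ ∑< M (δ (p * p))) (∑<-+ (δ 1) (δ p) M) ⟩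
    ∑< M (δ 1) + ∑< M (δ p) + ∑< M (δ (p * p))
      ≡⟨ cong₂ _+_ (cong₂ _+_ (∑<-δ 1 (<-trans 1<p p<M)) (∑<-δ p p<M)) (∑<-δ (p * p) ≤-refl) ⟩
    1 + p + p * p
      ∎
    where
    open ≡-Reasoning
    M = suc (p * p)
    p<M : p < M
    p<M = <-trans p<p*p (n<1+n (p * p))

p^[1∨2] : ∀ p {j} → j ≡ 1 ⊎ j ≡ 2 → ∃[ u ] p ^ j ≡ p * u × (u ≡ 1 ⊎ u ≡ p)
p^[1∨2] p (inj₁ refl) = 1 , refl , inj₁ refl
p^[1∨2] p (inj₂ refl) = p , cong (p *_) (*-identityʳ p) , inj₂ refl

factor-p : ∀ {p j g u v} B → p ^ j ≡ p * u → p ^ g ≡ p * v → p ^ j + B * p ^ g ≡ p * (u + B * v)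
factor-p {p} {u = u} {v} B p^j≡p*u p^g≡p*v = trans (cong₂ (λ x y → x + B * y) p^j≡p*u p^g≡p*v) (distrib p u B v)
  where
  distrib : ∀ p u B v → p * u + B * (p * v) ≡ p * (u + B * v)
  distrib = solve-∀

near-perfect-equation : ∀ {p k d₁ d₂} → Prime p → ¬ 2 ∣ p → σ (2 ^ k * p ^ 2) ≡ 2 * (2 ^ k * p ^ 2) + d₁ + d₂ →
             2 ^ suc k * (1 + p) ≡ 1 + p + p * p + (d₁ + d₂)
near-perfect-equation {p} {k} {d₁} {d₂} pr 2∤p eq = +-cancelˡ-≡ (N * (p * p)) _ _ (begin
  N * (p * p) + N * (1 + p)                  ≡⟨ expand N p ⟩
  N * (1 + p + p * p)                        ≡⟨ cong (N *_) (σ-p*p pr) ⟨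
  N * σ (p * p)                              ≡⟨ σ-2^k* (p * p) {{m*n≢0 p p}} 2∤p*p k ⟨
  σ (2 ^ k * (p * p)) + σ (p * p)            ≡⟨ cong₂ _+_ eq′ (σ-p*p pr) ⟩
  2 * (2 ^ k * (p * p)) + d₁ + d₂ + Q        ≡⟨ cong (λ x → x + d₁ + d₂ + Q) (*-assoc 2 (2 ^ k) (p * p)) ⟨
  N * (p * p) + d₁ + d₂ + Q                  ≡⟨ regroup (N * (p * p)) d₁ d₂ Q ⟩
  N * (p * p) + (Q + (d₁ + d₂))              ∎)
  where
  open ≡-Reasoning
  instance
    p≢0 : NonZero p
    p≢0 = prime⇒nonZero pr
  N = 2 ^ suc k
  Q = 1 + p + p * p
  expand : ∀ N p → N * (p * p) + N * (1 + p) ≡ N * (1 + p + p * p)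
  expand = solve-∀
  regroup : ∀ a b c d → a + b + c + d ≡ a + (d + (b + c))
  regroup = solve-∀
  2∤p*p : ¬ 2 ∣ p * p
  2∤p*p 2∣p*p = Sum.[ 2∤p , 2∤p ] (euclidsLemma p p prime[2] 2∣p*p)
  eq′ : σ (2 ^ k * (p * p)) ≡ 2 * (2 ^ k * (p * p)) + d₁ + d₂
  eq′ = subst (λ q → σ (2 ^ k * q) ≡ 2 * (2 ^ k * q) + d₁ + d₂) (cong (p *_) (*-identityʳ p)) eq

residue-one : ∀ {p N X} .{{_ : NonZero p}} → 1 < p → N * (1 + p) ≡ 1 + p + p * p + p * X →
              ∃[ m ] N ≡ 1 + m * p × m * (1 + p) ≡ p + X
residue-one {p} {N} {X} 1<p eq = m , N≡1+m*p , suc-injective (*-cancelˡ-≡ _ _ p (suc-injective (begin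
    1 + p * (1 + m * (1 + p))  ≡⟨ expand m p ⟨
    (1 + m * p) * (1 + p)      ≡⟨ cong (_* (1 + p)) N≡1+m*p ⟨
    N * (1 + p)                ≡⟨ eq′ ⟩
    1 + p * (1 + p + X)        ∎)))
  where
  open ≡-Reasoning
  m = N / p
  regroup : ∀ p X → 1 + p + p * p + p * X ≡ 1 + p * (1 + p + X)
  regroup = solve-∀
  eq′ : N * (1 + p) ≡ 1 + p * (1 + p + X)
  eq′ = trans eq (regroup p X)
  N%p≡1 : N % p ≡ 1
  N%p≡1 = begin
    N % p                      ≡⟨ [m+kn]%n≡m%n N N p ⟨
    (N + N * p) % p            ≡⟨ cong (_% p) (*-suc N p) ⟨
    (N * (1 + p)) % p          ≡⟨ cong (_% p) eq′ ⟩
    (1 + p * (1 + p + X)) % p  ≡⟨ cong (λ y → (1 + y) % p) (*-comm p (1 + p + X)) ⟩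
    (1 + (1 + p + X) * p) % p  ≡⟨ [m+kn]%n≡m%n 1 (1 + p + X) p ⟩
    1 % p                      ≡⟨ m<n⇒m%n≡m 1<p ⟩
    1                          ∎
  N≡1+m*p : N ≡ 1 + m * p
  N≡1+m*p = trans (m≡m%n+[m/n]*n N p) (cong (_+ m * p) N%p≡1)
  expand : ∀ m p → (1 + m * p) * (1 + p) ≡ 1 + p * (1 + m * (1 + p))
  expand = solve-∀

*[1+p]≡*p⇒≡*p : ∀ {p m e} .{{_ : NonZero p}} → m * (1 + p) ≡ e * p → ∃[ s ] m ≡ s * p × s * (1 + p) ≡ e
*[1+p]≡*p⇒≡*p {p} {m} {e} eq with coprime-divisor (coprime-1+ p) (divides e (trans (*-comm (1 + p) m) eq))
... | divides s refl = s , refl , *-cancelʳ-≡ _ _ p (trans (swap s p) eq)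
  where
  swap : ∀ s p → s * (1 + p) * p ≡ s * p * (1 + p)
  swap = solve-∀

-- B stands for 2^b and N for 2^(k+1); the last hypothesis of each case is the near-perfect
-- equation in the reduced form produced by residue-one.
module Odd (h : ℕ) where

  p : ℕ
  p = 1 + 2 * h

  ¬omit-p-Bp : ∀ {B N m} → 2 * B ∣ N → N ≡ 1 + m * p → m * (1 + p) ≡ p + (1 + B) → ⊥
  ¬omit-p-Bp {zero} 0∣N refl _ = 0∤1+n 0∣N
  ¬omit-p-Bp {suc B} {m = suc w} 2B∣N refl eq with +-cancelˡ-≡ (1 + p) _ _ (trans (sym (+-suc p (suc B))) (sym eq))
  ¬omit-p-Bp {suc B} {m = suc (suc w)} 2B∣N refl eq | refl = >⇒∤ (<-gap (2 * w + w * p) (expand w p)) 2B∣N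
    where
    expand : ∀ w p → 2 * ((1 + w) * (1 + p)) ≡ (1 + (2 + w) * p) + suc (2 * w + w * p)
    expand = solve-∀

  omit-p²-Bp⇒p≡5 : ∀ {B N m} → 2 * B ∣ N → N ≡ 1 + m * p → m * (1 + p) ≡ p + (p + B) → p ≡ 5 × N ≡ 16
  omit-p²-Bp⇒p≡5 {zero} 0∣N refl _ = ⊥-elim (0∤1+n 0∣N)
  omit-p²-Bp⇒p≡5 {suc B} {m = 1} _ refl eq = contradiction eq (<⇒≢ (<-gap (2 * h + B) (expand h B)))
    where
    expand : ∀ h B → (1 + 2 * h) + ((1 + 2 * h) + suc B) ≡ (1 * (2 + 2 * h)) + suc (2 * h + B)
    expand = solve-∀
  omit-p²-Bp⇒p≡5 {B} {m = 2} 2B∣N refl _ = contradiction (m*n∣⇒m∣ 2 B 2B∣N) (2∤1+2* p)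
  omit-p²-Bp⇒p≡5 {B} {m = 3} 2B∣N refl eq = cofactor (subst (λ b → 2 * b ∣ 1 + 3 * p) B≡3+p 2B∣N)
    where
    B≡3+p : B ≡ 3 + p
    B≡3+p = +-cancelˡ-≡ (p + p) B (3 + p) (trans (+-assoc p p B) (trans (sym eq) (split p)))
      where
      split : ∀ p → 3 * (1 + p) ≡ p + p + (3 + p)
      split = solve-∀
    cofactor : 2 * (3 + p) ∣ 1 + 3 * p → p ≡ 5 × 1 + 3 * p ≡ 16
    cofactor (divides 1 eqT) = p≡5 , cong (λ q → 1 + 3 * q) p≡5
      where
      p≡5 : p ≡ 5
      p≡5 = +-cancelˡ-≡ (1 + 2 * p) p 5 (trans (split₁ p) (trans eqT (split₂ p)))
        where
        split₁ : ∀ p → 1 + 2 * p + p ≡ 1 + 3 * p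
        split₁ = solve-∀
        split₂ : ∀ p → 1 * (2 * (3 + p)) ≡ 1 + 2 * p + 5
        split₂ = solve-∀
    cofactor (divides (suc (suc t)) eqT) = contradiction eqT (<⇒≢ (<-gap (10 + p + t * (2 * (3 + p))) (expand t p)))
      where
      expand : ∀ t p → (2 + t) * (2 * (3 + p)) ≡ (1 + 3 * p) + suc (10 + p + t * (2 * (3 + p)))
      expand = solve-∀
  omit-p²-Bp⇒p≡5 {B} {m = suc (suc (suc (suc r)))} 2B∣N refl eq =
    ⊥-elim (>⇒∤ (<-gap (6 + 2 * r + r * p) (trans (cong (2 *_) B≡) (expand r p))) 2B∣N)
    where
    expand : ∀ r p → 2 * (4 + 2 * p + r * (1 + p)) ≡ (1 + (4 + r) * p) + suc (6 + 2 * r + r * p)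
    expand = solve-∀
    B≡ : B ≡ 4 + 2 * p + r * (1 + p)
    B≡ = +-cancelˡ-≡ (p + p) B _ (trans (+-assoc p p B) (trans (sym eq) (split r p)))
      where
      split : ∀ r p → (4 + r) * (1 + p) ≡ p + p + (4 + 2 * p + r * (1 + p))
      split = solve-∀

  ¬omit-p-Bp² : ∀ {B N m} → 2 * B ∣ N → N ≡ 1 + m * p → m * (1 + p) ≡ p + (1 + B * p) → ⊥
  ¬omit-p-Bp² {B} {m = suc w} 2B∣N refl eq
    with *[1+p]≡*p⇒≡*p {m = w} {e = B} (+-cancelˡ-≡ (1 + p) _ _ (trans eq (+-suc p (B * p))))
  ... | zero  , refl , refl = 0∤1+n 2B∣N
  ... | suc z , refl , refl = ∤-between (<-gap (p + suc z) (below h z)) (<-gap (2 * h + 3 * z + 4 * z * h) (above h z)) 2B∣N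
    where
    below : ∀ h z → 1 + (1 + (1 + z) * (1 + 2 * h)) * (1 + 2 * h)
                  ≡ 2 * ((1 + z) * (2 + 2 * h)) * h + suc ((1 + 2 * h) + suc z)
    below = solve-∀
    above : ∀ h z → 2 * ((1 + z) * (2 + 2 * h)) * suc h
                  ≡ (1 + (1 + (1 + z) * (1 + 2 * h)) * (1 + 2 * h)) + suc (2 * h + 3 * z + 4 * z * h)
    above = solve-∀

  ¬omit-p²-Bp² : ∀ {B N m} → 2 * B ∣ N → N ≡ 1 + m * p → m * (1 + p) ≡ p + (p + B * p) → ⊥
  ¬omit-p²-Bp² {B} {m = m} 2B∣N refl eq
    with *[1+p]≡*p⇒≡*p {m = m} {e = 2 + B} (trans eq (factor p B))
    where
    factor : ∀ p B → p + (p + B * p) ≡ (2 + B) * p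
    factor = solve-∀
  ... | 1 , refl , 1+p≡2+B = even≢odd h 0 (trans (sym B≡2h) (∣1⇒≡1 B∣1))
    where
    B≡2h : B ≡ 2 * h
    B≡2h = trans (sym (suc-injective (suc-injective 1+p≡2+B))) (+-identityʳ (2 * h))
    split : ∀ h → 1 + 1 * (1 + 2 * h) * (1 + 2 * h) ≡ 2 * (2 * h) * (1 + h) + 2
    split = solve-∀
    N≡2B[1+h]+2 : 1 + 1 * p * p ≡ 2 * B * (1 + h) + 2
    N≡2B[1+h]+2 = trans (split h) (cong (λ b → 2 * b * (1 + h) + 2) (sym B≡2h))
    B∣1 : B ∣ 1
    B∣1 = *-cancelˡ-∣ 2 (∣m+n∣m⇒∣n (subst (2 * B ∣_) N≡2B[1+h]+2 2B∣N) (m∣m*n (1 + h)))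
  ... | suc (suc r) , refl , refl = ∤-between (<-gap (r + 2 * p) (below h r)) (<-gap (4 * h + r * (2 * p + 1)) (above h r)) 2B∣N
    where
    below : ∀ h r → 1 + (2 + r) * (1 + 2 * h) * (1 + 2 * h)
                  ≡ 2 * (2 * h + (1 + r) * (2 + 2 * h)) * h + suc (r + 2 * (1 + 2 * h))
    below = solve-∀
    above : ∀ h r → 2 * (2 * h + (1 + r) * (2 + 2 * h)) * suc h
                  ≡ (1 + (2 + r) * (1 + 2 * h) * (1 + 2 * h)) + suc (4 * h + r * (2 * (1 + 2 * h) + 1))
    above = solve-∀

  omit⇒p≡5 : ∀ {B N m u v} → 2 * B ∣ N → N ≡ 1 + m * p → u ≡ 1 ⊎ u ≡ p → v ≡ 1 ⊎ v ≡ p →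
             m * (1 + p) ≡ p + (u + B * v) → p ≡ 5 × N ≡ 16
  omit⇒p≡5 {B} {N} {m} 2B∣N N≡ (inj₁ refl) (inj₁ refl) eq =
    ⊥-elim (¬omit-p-Bp {B} {N} {m} 2B∣N N≡ (trans eq (cong (λ x → p + (1 + x)) (*-identityʳ B))))
  omit⇒p≡5 {B} {N} {m} 2B∣N N≡ (inj₂ refl) (inj₁ refl) eq =
    omit-p²-Bp⇒p≡5 {B} {N} {m} 2B∣N N≡ (trans eq (cong (λ x → p + (p + x)) (*-identityʳ B)))
  omit⇒p≡5 {B} {N} {m} 2B∣N N≡ (inj₁ refl) (inj₂ refl) eq = ⊥-elim (¬omit-p-Bp² {B} {N} {m} 2B∣N N≡ eq)
  omit⇒p≡5 {B} {N} {m} 2B∣N N≡ (inj₂ refl) (inj₂ refl) eq = ⊥-elim (¬omit-p²-Bp² {B} {N} {m} 2B∣N N≡ eq)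

proposition13 : (k p j g b : ℕ) → Prime p → ¬ (p ≡ 2) → 1 ≤ k →
    (j ≡ 1 ⊎ j ≡ 2) → (g ≡ 1 ⊎ g ≡ 2) → 1 ≤ b → b ≤ k →
    NearPerfectWith (2 ^ k * p ^ 2) (p ^ j) (2 ^ b * p ^ g) →
    2 ^ k * p ^ 2 ≡ 200
proposition13 k p j g b pr p≢2 _ j∈ g∈ _ b≤k (_ , _ , _ , _ , _ , σ≡)
  with odd⇒≡1+2* (prime≢2⇒2∤ pr p≢2) | p^[1∨2] p j∈ | p^[1∨2] p g∈
... | h , refl | u , p^j≡p*u , u∈ | v , p^g≡p*v , v∈
  with residue-one {X = u + 2 ^ b * v} (nonTrivial⇒n>1 p {{prime⇒nonTrivial pr}})
         (trans (near-perfect-equation {k = k} pr (prime≢2⇒2∤ pr p≢2) σ≡)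
                (cong (1 + p + p * p +_) (factor-p {p} {j} {g} {u} {v} (2 ^ b) p^j≡p*u p^g≡p*v)))
... | m , N≡1+m*p , eq
  with Odd.omit⇒p≡5 h {2 ^ b} {2 ^ suc k} {m} (*-monoʳ-∣ 2 (^-monoʳ-∣ 2 b≤k)) N≡1+m*p u∈ v∈ eq
... | p≡5 , N≡16 = cong₂ _*_ (*-cancelˡ-≡ (2 ^ k) 8 2 N≡16) (cong (_^ 2) p≡5)
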